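{- Let $k\ge3$ be odd, let $H$ be a Kimura Hadamard matrix of order $8k+4$, and let $(R,S)\in\mathrm{Aut}(H)$. (a) If $R$ fixes the first row of $H$, i.e. $R_{11}=1$, then $S$ is a permutation matrix (it has no entries equal to $-1$). (b) If $R$ fixes each of the first four rows of $H$, i.e. $R_{ii}=1$ for $i=1,2,3,4$, then $S$ also fixes each of the first four columns ($S_{jj}=1$ for $j=1,2,3,4$), and $R$ and $S$ preserve the block structure of $H$: $R=\mathrm{diag}(I_4,R_1,R_2,R_3,R_4)$ and $S=\mathrm{diag}(I_4,S_1,S_2,S_3,S_4)$ with $R_p,S_q$ signed permutation matrices of size $2k$; in particular each $2k\times2k$ block $H_{pq}$ ($p,q\in\{1,\dots,4\}$) of $H$ in rows and columns $5,\dots,8k+4$ satisfies $R_pH_{pq}S_q^\intercal=H_{pq}$.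
   Context: $D_{2k}=\langle x,y\mid x^k=1,\ y^2=1,\ y^{ -1}xy=x^{ -1}\rangle$, with elements listed in the order $x^0,\dots,x^{k-1},y,xy,\dots,x^{k-1}y$, which indexes rows and columns of $2k\times2k$ matrices. $\rho(g)=[\delta_{ug,v}]_{u,v}$ is the right regular matrix representation, extended linearly to $\mathbb{Z}D_{2k}$; for $w\in\mathbb{Z}D_{2k}$ with coefficients in $\{0,1\}$ its associated $\pm1$-matrix is $2\rho(w)-J_{2k}$. A Kimura Hadamard matrix of order $8k+4$ is a matrix \[ H=\begin{bmatrix} 1& 1 & 1 & 1 & \mathbf{1} & \mathbf{1} & \mathbf{1} & \mathbf{1}\\ 1& 1 & -1 & -1 & \mathbf{1} & \mathbf{1} & -\mathbf{1} & -\mathbf{1}\\ 1& -1 & 1 & -1 & \mathbf{1} & -\mathbf{1} & \mathbf{1} & -\mathbf{1}\\ 1& -1 & -1 & 1 & -\mathbf{1} & \mathbf{1} & \mathbf{1} & -\mathbf{1}\\ \mathbf{1}^\intercal & \mathbf{1}^\intercal & \mathbf{1}^\intercal & -\mathbf{1}^\intercal & A & B& C & D\\ \mathbf{1}^\intercal & \mathbf{1}^\intercal& -\mathbf{1}^\intercal & \mathbf{1}^\intercal & -B & A & D & -C\\ \mathbf{1}^\intercal & -\mathbf{1}^\intercal& \mathbf{1}^\intercal & \mathbf{1}^\intercal & -C & -D & A & B\\ \mathbf{1}^\intercal & -\mathbf{1}^\intercal& -\mathbf{1}^\intercal & -\mathbf{1}^\intercal & D & -C & B & -A \end{bmatrix}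 \] ($\mathbf 1$ the all-ones row vector of length $2k$) with $HH^\intercal=(8k+4)I_{8k+4}$, where $A,B,C,D$ are the $\pm1$-matrices associated to some $a,b,c,d\in\mathbb{Z}D_{2k}$ with coefficients in $\{0,1\}$. $\mathrm{Aut}(H)=\{(R,S): R,S\ \text{are}\ (8k+4)\times(8k+4)\ \text{signed permutation matrices},\ RHS^\intercal=H\}$. $\mathrm{diag}$ denotes a block diagonal matrix. -}

module Defs where

open import Data.Bool using (Bool; true; false; if_then_else_; _xor_)
open import Data.Nat as ℕ using (ℕ; zero; suc; _<ᵇ_; _∸_; _≡ᵇ_)
open import Data.Integer as ℤ using (ℤ; 0ℤ; 1ℤ; -1ℤ; _*_; _+_; _-_; -_)
open import Data.Fin as Fin using (Fin; toℕ; splitAt; remQuot; combine; _↑ʳ_; _↑ˡ_)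
open import Data.Fin.Permutation using (Permutation′; _⟨$⟩ʳ_)
open import Data.Sum using (_⊎_; inj₁; inj₂)
open import Data.Product using (_×_; _,_; ∃-syntax; Σ-syntax)
open import Relation.Nullary.Decidable using (⌊_⌋)
open import Relation.Binary.PropositionalEquality using (_≡_)

Matrix : ℕ → ℕ → Set
Matrix m n = Fin m → Fin n → ℤ

∑ : ∀ {n} → (Fin n → ℤ) → ℤ
∑ {zero}  f = 0ℤ
∑ {suc n} f = f Fin.zero + ∑ (λ i → f (Fin.suc i))

_·_ : ∀ {m n p} → Matrix m n → Matrix n p → Matrix m p
(M · N) i j = ∑ (λ l → M i l * N l j)

infixl 7 _·_

_ᵀ : ∀ {m n} → Matrix m n → Matrix n m
(M ᵀ) i j = M j i

infix 10 _ᵀ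

_≐_ : ∀ {m n} → Matrix m n → Matrix m n → Set
M ≐ N = ∀ i j → M i j ≡ N i j

infix 4 _≐_

δ : ∀ {n} → Fin n → Fin n → ℤ
δ i j = if ⌊ i Fin.≟ j ⌋ then 1ℤ else 0ℤ

I : ∀ n → Matrix n n
I n = δ

J : ∀ n → Matrix n n
J n _ _ = 1ℤ

scale : ∀ {m n} → ℤ → Matrix m n → Matrix m n
scale c M i j = c * M i j

IsSignedPerm : ∀ {n} → Matrix n n → Set
IsSignedPerm {n} M =
  Σ[ σ ∈ Permutation′ n ] Σ[ s ∈ (Fin n → ℤ) ] ((∀ i → s i ≡ 1ℤ ⊎ s i ≡ -1ℤ) ×
    (∀ i j → M i j ≡ (if ⌊ j Fin.≟ (σ ⟨$⟩ʳ i) ⌋ then s i else 0ℤ)))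

-- The dihedral group D_{2k} = ⟨x, y⟩, element x^i y^e (0 ≤ i < k, e ∈ {0,1})
-- has index i + e·k in {0, …, 2k-1}: order x^0,…,x^{k-1}, y, xy, …, x^{k-1}y.

module Dihedral (k : ℕ) where

  expo : Fin (2 ℕ.* k) → ℕ
  expo u = if toℕ u <ᵇ k then toℕ u else toℕ u ∸ k

  refl? : Fin (2 ℕ.* k) → Bool
  refl? u = if toℕ u <ᵇ k then false else true

  red : ℕ → ℕ
  red s = if s <ᵇ k then s else s ∸ k

  -- x^i y^e · x^j y^f = x^{i + (-1)^e j} y^{e+f}
  mulExpo : Fin (2 ℕ.* k) → Fin (2 ℕ.* k) → ℕ
  mulExpo u g = if refl? u then red (expo u ℕ.+ (k ∸ expo g))
                           else red (expo u ℕ.+ expo g)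

  mulIdx : Fin (2 ℕ.* k) → Fin (2 ℕ.* k) → ℕ
  mulIdx u g = mulExpo u g ℕ.+ (if refl? u xor refl? g then k else 0)

  -- right regular representation: ρ(g)_{u,v} = δ_{ug,v}
  ρ : Fin (2 ℕ.* k) → Matrix (2 ℕ.* k) (2 ℕ.* k)
  ρ g u v = if mulIdx u g ≡ᵇ toℕ v then 1ℤ else 0ℤ

  -- an element w of ℤD_{2k} with coefficients in {0,1}, given by its coefficient
  -- function; ρ extended linearly
  coeff : Bool → ℤ
  coeff true  = 1ℤ
  coeff false = 0ℤ

  ρL : (Fin (2 ℕ.* k) → Bool) → Matrix (2 ℕ.* k) (2 ℕ.* k)
  ρL w u v = ∑ (λ g → coeff (w g) * ρ g u v)

  pm : (Fin (2 ℕ.* k) → Bool) → Matrix (2 ℕ.* k) (2 ℕ.* k)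
  pm w u v = ℤ.+ 2 * ρL w u v - J (2 ℕ.* k) u v

Ord : ℕ → ℕ
Ord n = 4 ℕ.+ 4 ℕ.* n

view : ∀ {n} → Fin (Ord n) → Fin 4 ⊎ (Fin 4 × Fin n)
view {n} r with splitAt 4 r
... | inj₁ i = inj₁ i
... | inj₂ t = inj₂ (remQuot {4} n t)

emb : ∀ {n} → Fin 4 → Fin n → Fin (Ord n)
emb p u = 4 ↑ʳ combine p u

block : ∀ {n} → Matrix (Ord n) (Ord n) → Fin 4 → Fin 4 → Matrix n n
block H p q u v = H (emb p u) (emb q v)

blockDiag : ∀ {n} → (Fin 4 → Matrix n n) → Matrix (Ord n) (Ord n)
blockDiag M r c with view r | view c
... | inj₁ i       | inj₁ j       = δ i j
... | inj₂ (p , u) | inj₂ (q , v) = if ⌊ p Fin.≟ q ⌋ then M p u v else 0ℤ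
... | _            | _            = 0ℤ

TL : Fin 4 → Fin 4 → ℤ
TL i j = tbl (toℕ i) (toℕ j)
  where
  tbl : ℕ → ℕ → ℤ
  tbl 0 _ = 1ℤ
  tbl 1 0 = 1ℤ
  tbl 1 1 = 1ℤ
  tbl 1 _ = -1ℤ
  tbl 2 0 = 1ℤ
  tbl 2 1 = -1ℤ
  tbl 2 2 = 1ℤ
  tbl 2 _ = -1ℤ
  tbl _ 0 = 1ℤ
  tbl _ 1 = -1ℤ
  tbl _ 2 = -1ℤ
  tbl _ _ = 1ℤ

-- sign of the all-ones block in row i (of the first four), column block q
TR : Fin 4 → Fin 4 → ℤ
TR i q = tbl (toℕ i) (toℕ q)
  where
  tbl : ℕ → ℕ → ℤ
  tbl 0 _ = 1ℤ
  tbl 1 0 = 1ℤ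
  tbl 1 1 = 1ℤ
  tbl 1 _ = -1ℤ
  tbl 2 0 = 1ℤ
  tbl 2 1 = -1ℤ
  tbl 2 2 = 1ℤ
  tbl 2 _ = -1ℤ
  tbl _ 0 = -1ℤ
  tbl _ 1 = 1ℤ
  tbl _ 2 = 1ℤ
  tbl _ _ = -1ℤ

-- sign of the all-ones column block in row block p, column j (of the first four)
BL : Fin 4 → Fin 4 → ℤ
BL p j = tbl (toℕ p) (toℕ j)
  where
  tbl : ℕ → ℕ → ℤ
  tbl 0 3 = -1ℤ
  tbl 0 _ = 1ℤ
  tbl 1 2 = -1ℤ
  tbl 1 _ = 1ℤ
  tbl 2 1 = -1ℤ
  tbl 2 _ = 1ℤ
  tbl _ 0 = 1ℤ
  tbl _ _ = -1ℤ

BR : ∀ {n} → (A B C D : Matrix n n) → Fin 4 → Fin 4 → Matrix n n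
BR {n} A B C D p q = tbl (toℕ p) (toℕ q)
  where
  neg : Matrix n n → Matrix n n
  neg M u v = - M u v
  tbl : ℕ → ℕ → Matrix n n
  tbl 0 0 = A
  tbl 0 1 = B
  tbl 0 2 = C
  tbl 0 _ = D
  tbl 1 0 = neg B
  tbl 1 1 = A
  tbl 1 2 = D
  tbl 1 _ = neg C
  tbl 2 0 = neg C
  tbl 2 1 = neg D
  tbl 2 2 = A
  tbl 2 _ = B
  tbl _ 0 = D
  tbl _ 1 = neg C
  tbl _ 2 = B
  tbl _ _ = neg A

kimuraArray : ∀ {n} → (A B C D : Matrix n n) → Matrix (Ord n) (Ord n)
kimuraArray A B C D r c with view r | view c
... | inj₁ i       | inj₁ j       = TL i j
... | inj₁ i       | inj₂ (q , _) = TR i q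
... | inj₂ (p , _) | inj₁ j       = BL p j
... | inj₂ (p , u) | inj₂ (q , v) = BR A B C D p q u v

kimura : (k : ℕ) → (a b c d : Fin (2 ℕ.* k) → Bool) → Matrix (Ord (2 ℕ.* k)) (Ord (2 ℕ.* k))
kimura k a b c d = kimuraArray (pm a) (pm b) (pm c) (pm d)
  where open Dihedral k

IsHadamard : ∀ {N} → Matrix N N → Set
IsHadamard {N} H = H · H ᵀ ≐ scale (ℤ.+ N) (I N)

IsAut : ∀ {N} → Matrix N N → Matrix N N → Matrix N N → Set
IsAut H R S = IsSignedPerm R × IsSignedPerm S × (R · H · S ᵀ ≐ H)

{-# OPTIONS --safe #-}

-- If R and S are signed permutation matrices with permutations σR, σS and signs sR, sS, the
-- automorphism equation says H i j = sR i · H (σR i) (σS j) · sS j.  The first row of a Kimura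
-- array is all ones, so if R fixes it every sign of S is +1.  If R fixes the first four rows,
-- then columns c and σS c agree on them; the signs of rows 2–4 determine which of the eight
-- parts of the index set (one of the first four indices, or one of the four blocks) a column
-- lies in, so σS preserves parts.  In particular σS fixes the all-ones first column, which
-- forces the signs of R to be +1, and the same argument on columns shows that σR preserves
-- parts.  Permutation matrices of part-preserving permutations are block diagonal, and the
-- automorphism equation restricts to every block.

module Submission where

open import Defs
open import Data.Bool using (Bool; if_then_else_)
open import Data.Nat as ℕ using (ℕ; _≤_; _+_; _*_; s≤s; s≤s⁻¹)
open import Data.Integer using (ℤ; 0ℤ; 1ℤ; -1ℤ; sign) renaming (_*_ to _*ℤ_; _+_ to _+ℤ_)
import Data.Integer.Properties as ℤ
open import Data.Fin using (Fin; zero; suc; toℕ; _↑ˡ_; _↑ʳ_; combine; splitAt)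
open import Data.Fin.Properties
  using (_≟_; toℕ-↑ˡ; toℕ<n; ↑ˡ-injective; ↑ʳ-injective; combine-injective; splitAt-↑ˡ; splitAt-↑ʳ;
         splitAt⁻¹-↑ˡ; splitAt⁻¹-↑ʳ; splitAt-<; remQuot-combine; combine-remQuot)
open import Data.Fin.Patterns using (0F; 1F; 2F; 3F)
open import Data.Fin.Permutation using (Permutation′; _⟨$⟩ʳ_; _⟨$⟩ˡ_; inverseˡ; inverseʳ; permutation)
open import Data.Sign using (Sign)
open import Data.Product using (_×_; _,_; proj₁; proj₂; ∃-syntax; Σ-syntax)
open import Data.Sum using (_⊎_; inj₁; inj₂)
open import Relation.Nullary using (yes; no; contradiction)
open import Relation.Nullary.Decidable using (⌊_⌋; ⌊⌋-map′)
open import Relation.Binary.PropositionalEquality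
  using (_≡_; _≢_; refl; sym; trans; cong; cong₂; subst; module ≡-Reasoning)

open ≡-Reasoning

∑-cong : ∀ {n} {f g : Fin n → ℤ} → (∀ i → f i ≡ g i) → ∑ f ≡ ∑ g
∑-cong {ℕ.zero}  f≗g = refl
∑-cong {ℕ.suc n} f≗g = cong₂ _+ℤ_ (f≗g zero) (∑-cong (λ i → f≗g (suc i)))

∑-zero : ∀ n → ∑ {n} (λ _ → 0ℤ) ≡ 0ℤ
∑-zero ℕ.zero    = refl
∑-zero (ℕ.suc n) = trans (ℤ.+-identityˡ _) (∑-zero n)

∑-indicator : ∀ {n} (t : Fin n) (f : Fin n → ℤ) →
  ∑ (λ l → if ⌊ l ≟ t ⌋ then f l else 0ℤ) ≡ f t
∑-indicator {ℕ.suc n} zero    f = trans (cong (f zero +ℤ_) (∑-zero n)) (ℤ.+-identityʳ (f zero))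
∑-indicator {ℕ.suc n} (suc t) f = trans (ℤ.+-identityˡ _) (begin
  ∑ (λ l → if ⌊ suc l ≟ suc t ⌋ then f (suc l) else 0ℤ)
    ≡⟨ ∑-cong (λ l → cong (λ b → if b then f (suc l) else 0ℤ) (⌊⌋-map′ _ _ (l ≟ t))) ⟩
  ∑ (λ l → if ⌊ l ≟ t ⌋ then f (suc l) else 0ℤ)
    ≡⟨ ∑-indicator t (λ l → f (suc l)) ⟩
  f (suc t) ∎)

*-identity-sandwich : ∀ {a b} x → a ≡ 1ℤ → b ≡ 1ℤ → a *ℤ x *ℤ b ≡ x
*-identity-sandwich x refl refl = trans (ℤ.*-identityʳ _) (ℤ.*-identityˡ x)

by-cases-≟ : ∀ {n} {x y : Fin n} {m a : ℤ} →
  (x ≡ y → m ≡ a) → (x ≢ y → m ≡ 0ℤ) → m ≡ (if ⌊ x ≟ y ⌋ then a else 0ℤ)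
by-cases-≟ {x = x} {y} on off with x ≟ y
... | yes x≡y = on x≡y
... | no x≢y  = off x≢y

-- A record rather than a function type, so that σ, s and M can be inferred from a proof.
record SignedPermBy {n} (σ : Permutation′ n) (s : Fin n → ℤ) (M : Matrix n n) : Set where
  constructor signedPermBy
  field entry : ∀ i j → M i j ≡ (if ⌊ j ≟ σ ⟨$⟩ʳ i ⌋ then s i else 0ℤ)

PermMatrixBy : ∀ {n} → Permutation′ n → Matrix n n → Set
PermMatrixBy σ = SignedPermBy σ (λ _ → 1ℤ)

permMatrix-isSignedPerm : ∀ {n} {σ : Permutation′ n} {M : Matrix n n} → PermMatrixBy σ M → IsSignedPerm M
permMatrix-isSignedPerm {σ = σ} M≡ = σ , (λ _ → 1ℤ) , (λ _ → inj₁ refl) , SignedPermBy.entry M≡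

module _ {n} {σ : Permutation′ n} {s : Fin n → ℤ} {M : Matrix n n}
         (M≡ : SignedPermBy σ s M) where

  open SignedPermBy M≡

  entry-on : ∀ {i j} → σ ⟨$⟩ʳ i ≡ j → M i j ≡ s i
  entry-on {i} {j} σi≡j with j ≟ σ ⟨$⟩ʳ i | entry i j
  ... | yes _    | Mij≡ = Mij≡
  ... | no j≢σi  | _    = contradiction (sym σi≡j) j≢σi

  entry-off : ∀ {i j} → j ≢ σ ⟨$⟩ʳ i → M i j ≡ 0ℤ
  entry-off {i} {j} j≢σi with j ≟ σ ⟨$⟩ʳ i | entry i j
  ... | yes j≡σi | _    = contradiction j≡σi j≢σi
  ... | no _     | Mij≡ = Mij≡

  diagonal≡1⇒fixed : ∀ {i} → M i i ≡ 1ℤ → σ ⟨$⟩ʳ i ≡ i × s i ≡ 1ℤ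
  diagonal≡1⇒fixed {i} Mii≡1 with i ≟ σ ⟨$⟩ʳ i
  ... | yes i≡σi = sym i≡σi , trans (sym (entry-on (sym i≡σi))) Mii≡1
  ... | no i≢σi  = contradiction (trans (sym (entry-off i≢σi)) Mii≡1) λ ()

  entry≢-1 : ∀ {i} → s i ≡ 1ℤ → ∀ j → M i j ≢ -1ℤ
  entry≢-1 {i} si≡1 j Mij≡-1 with j ≟ σ ⟨$⟩ʳ i
  ... | yes j≡σi = contradiction (trans (sym (trans (entry-on (sym j≡σi)) si≡1)) Mij≡-1) λ ()
  ... | no j≢σi  = contradiction (trans (sym (entry-off j≢σi)) Mij≡-1) λ ()

  unitSigns⇒permMatrix : (∀ i → s i ≡ 1ℤ) → PermMatrixBy σ M
  unitSigns⇒permMatrix s≡1 = signedPermBy λ i j →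
    trans (entry i j) (cong (λ x → if ⌊ j ≟ σ ⟨$⟩ʳ i ⌋ then x else 0ℤ) (s≡1 i))

  row-∑ : ∀ i (f : Fin n → ℤ) → ∑ (λ l → M i l *ℤ f l) ≡ s i *ℤ f (σ ⟨$⟩ʳ i)
  row-∑ i f = trans (∑-cong term) (∑-indicator (σ ⟨$⟩ʳ i) (λ l → s i *ℤ f l))
    where
    term : ∀ l → M i l *ℤ f l ≡ (if ⌊ l ≟ σ ⟨$⟩ʳ i ⌋ then s i *ℤ f l else 0ℤ)
    term l with l ≟ σ ⟨$⟩ʳ i
    ... | yes l≡σi = cong (_*ℤ f l) (entry-on (sym l≡σi))
    ... | no l≢σi  = trans (cong (_*ℤ f l) (entry-off l≢σi)) (ℤ.*-zeroˡ (f l))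

  col-∑ : ∀ j (f : Fin n → ℤ) → ∑ (λ l → f l *ℤ M j l) ≡ f (σ ⟨$⟩ʳ j) *ℤ s j
  col-∑ j f = begin
    ∑ (λ l → f l *ℤ M j l)   ≡⟨ ∑-cong (λ l → ℤ.*-comm (f l) (M j l)) ⟩
    ∑ (λ l → M j l *ℤ f l)   ≡⟨ row-∑ j f ⟩
    s j *ℤ f (σ ⟨$⟩ʳ j)      ≡⟨ ℤ.*-comm (s j) _ ⟩
    f (σ ⟨$⟩ʳ j) *ℤ s j      ∎

signedPerm-·-·ᵀ : ∀ {n} {σ τ : Permutation′ n} {s t} {M N : Matrix n n} →
  SignedPermBy σ s M → SignedPermBy τ t N → ∀ X i j →
  (M · X · N ᵀ) i j ≡ s i *ℤ X (σ ⟨$⟩ʳ i) (τ ⟨$⟩ʳ j) *ℤ t j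
signedPerm-·-·ᵀ {σ = σ} {τ} {s} {t} {M} {N} M≡ N≡ X i j = begin
  ∑ (λ l → (M · X) i l *ℤ N j l)                ≡⟨ ∑-cong (λ l → cong (_*ℤ N j l) (row-∑ M≡ i (λ m → X m l))) ⟩
  ∑ (λ l → s i *ℤ X (σ ⟨$⟩ʳ i) l *ℤ N j l)       ≡⟨ col-∑ N≡ j (λ l → s i *ℤ X (σ ⟨$⟩ʳ i) l) ⟩
  s i *ℤ X (σ ⟨$⟩ʳ i) (τ ⟨$⟩ʳ j) *ℤ t j          ∎

module Blocks (n : ℕ) where

  BlockIndex : Set
  BlockIndex = Fin 4 ⊎ (Fin 4 × Fin n)

  border : Fin 4 → Fin (Ord n)
  border i = i ↑ˡ (4 * n)

  unview : BlockIndex → Fin (Ord n)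
  unview (inj₁ i)       = border i
  unview (inj₂ (p , u)) = emb p u

  view-unview : ∀ x → view {n} (unview x) ≡ x
  view-unview (inj₁ i) rewrite splitAt-↑ˡ 4 i (4 * n) = refl
  view-unview (inj₂ (p , u)) rewrite splitAt-↑ʳ 4 (4 * n) (combine p u) | remQuot-combine p u = refl

  unview-view : ∀ r → unview (view {n} r) ≡ r
  unview-view r with splitAt 4 r in eq
  ... | inj₁ i = splitAt⁻¹-↑ˡ eq
  ... | inj₂ t = trans (cong (4 ↑ʳ_) (combine-remQuot {4} n t)) (splitAt⁻¹-↑ʳ eq)

  emb-injective : ∀ p u q v → emb {n} p u ≡ emb q v → p ≡ q × u ≡ v
  emb-injective p u q v e = combine-injective p u q v (↑ʳ-injective 4 _ _ e)

  border-toℕ≤3 : ∀ i → toℕ (border i) ≤ 3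
  border-toℕ≤3 i = subst (_≤ 3) (sym (toℕ-↑ˡ i (4 * n))) (s≤s⁻¹ (toℕ<n i))

  toℕ≤3⇒border : ∀ j → toℕ j ≤ 3 → ∃[ i ] border i ≡ j
  toℕ≤3⇒border j j≤3 = _ , splitAt⁻¹-↑ˡ (splitAt-< 4 j (s≤s j≤3))

  diagonalBlocks : Matrix (Ord n) (Ord n) → Fin 4 → Matrix n n
  diagonalBlocks M p = block M p p

  part : BlockIndex → Fin 4 ⊎ Fin 4
  part (inj₁ i)       = inj₁ i
  part (inj₂ (p , _)) = inj₂ p

  partOf : Fin (Ord n) → Fin 4 ⊎ Fin 4
  partOf r = part (view {n} r)

  partOf-border : ∀ i → partOf (border i) ≡ inj₁ i
  partOf-border i = cong part (view-unview (inj₁ i))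

  partOf-emb : ∀ p u → partOf (emb p u) ≡ inj₂ p
  partOf-emb p u = cong part (view-unview (inj₂ (p , u)))

  partOf≡inj₁ : ∀ r {i} → partOf r ≡ inj₁ i → r ≡ border i
  partOf≡inj₁ r e with view {n} r | unview-view r
  partOf≡inj₁ r refl | inj₁ i | r≡ = sym r≡

  partOf≡inj₂ : ∀ r {p} → partOf r ≡ inj₂ p → ∃[ u ] r ≡ emb p u
  partOf≡inj₂ r e with view {n} r | unview-view r
  partOf≡inj₂ r refl | inj₂ (p , u) | r≡ = u , sym r≡

  border≢emb : ∀ i p u → border i ≢ emb p u
  border≢emb i p u e with trans (sym (partOf-border i)) (trans (cong partOf e) (partOf-emb p u))
  ... | ()

  module PartPreserving (g : Fin (Ord n) → Fin (Ord n)) (g-part : ∀ r → partOf (g r) ≡ partOf r) where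

    onBlock : Fin 4 → Fin n → Fin n
    onBlock p u = proj₁ (partOf≡inj₂ (g (emb p u)) (trans (g-part (emb p u)) (partOf-emb p u)))

    g-emb : ∀ p u → g (emb p u) ≡ emb p (onBlock p u)
    g-emb p u = proj₂ (partOf≡inj₂ (g (emb p u)) (trans (g-part (emb p u)) (partOf-emb p u)))

    g-border : ∀ i → g (border i) ≡ border i
    g-border i = partOf≡inj₁ (g (border i)) (trans (g-part (border i)) (partOf-border i))

  module PartPreservingPermutation (σ : Permutation′ (Ord n))
                                   (σ-part : ∀ r → partOf (σ ⟨$⟩ʳ r) ≡ partOf r) where

    σ⁻¹-part : ∀ r → partOf (σ ⟨$⟩ˡ r) ≡ partOf r
    σ⁻¹-part r = trans (sym (σ-part (σ ⟨$⟩ˡ r))) (cong partOf (inverseʳ σ))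

    module Forward  = PartPreserving (σ ⟨$⟩ʳ_) σ-part
    module Backward = PartPreserving (σ ⟨$⟩ˡ_) σ⁻¹-part

    restrict : Fin 4 → Permutation′ n
    restrict p = permutation (Forward.onBlock p) (Backward.onBlock p) to∘from from∘to
      where
      to∘from : ∀ v → Forward.onBlock p (Backward.onBlock p v) ≡ v
      to∘from v = proj₂ (emb-injective p _ p v (begin
        emb p (Forward.onBlock p (Backward.onBlock p v)) ≡⟨ Forward.g-emb p _ ⟨
        σ ⟨$⟩ʳ emb p (Backward.onBlock p v)              ≡⟨ cong (σ ⟨$⟩ʳ_) (Backward.g-emb p v) ⟨
        σ ⟨$⟩ʳ (σ ⟨$⟩ˡ emb p v)                          ≡⟨ inverseʳ σ ⟩
        emb p v                                          ∎))
      from∘to : ∀ u → Backward.onBlock p (Forward.onBlock p u) ≡ u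
      from∘to u = proj₂ (emb-injective p _ p u (begin
        emb p (Backward.onBlock p (Forward.onBlock p u)) ≡⟨ Backward.g-emb p _ ⟨
        σ ⟨$⟩ˡ emb p (Forward.onBlock p u)               ≡⟨ cong (σ ⟨$⟩ˡ_) (Forward.g-emb p u) ⟨
        σ ⟨$⟩ˡ (σ ⟨$⟩ʳ emb p u)                          ≡⟨ inverseˡ σ ⟩
        emb p u                                          ∎))

    σ-emb : ∀ p u → σ ⟨$⟩ʳ emb p u ≡ emb p (restrict p ⟨$⟩ʳ u)
    σ-emb = Forward.g-emb

    σ-border : ∀ i → σ ⟨$⟩ʳ border i ≡ border i
    σ-border = Forward.g-border

    module _ {M : Matrix (Ord n) (Ord n)} (M≡ : PermMatrixBy σ M) where

      block-permMatrix : ∀ p → PermMatrixBy (restrict p) (diagonalBlocks M p)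
      block-permMatrix p = signedPermBy λ u v → by-cases-≟
        (λ v≡πu → entry-on M≡ (trans (σ-emb p u) (cong (emb p) (sym v≡πu))))
        (λ v≢πu → entry-off M≡ (λ e → v≢πu (proj₂ (emb-injective p v p _ (trans e (σ-emb p u))))))

      blockDiag-blocks : M ≐ blockDiag (diagonalBlocks M)
      blockDiag-blocks r c with view {n} r | unview-view r | view {n} c | unview-view c
      ... | inj₁ i | refl | inj₁ j | refl = by-cases-≟
        (λ { refl → entry-on M≡ (σ-border i) })
        (λ i≢j → entry-off M≡ (λ e → i≢j (sym (↑ˡ-injective _ j i (trans e (σ-border i))))))
      ... | inj₁ i | refl | inj₂ (q , v) | refl =
        entry-off M≡ (λ e → border≢emb i q v (sym (trans e (σ-border i))))
      ... | inj₂ (p , u) | refl | inj₁ j | refl =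
        entry-off M≡ (λ e → border≢emb j p _ (trans e (σ-emb p u)))
      ... | inj₂ (p , u) | refl | inj₂ (q , v) | refl = by-cases-≟
        (λ { refl → refl })
        (λ p≢q → entry-off M≡ (λ e → p≢q (sym (proj₁ (emb-injective q v p _ (trans e (σ-emb p u)))))))

  blockwise-invariance :
    ∀ {σ τ : Permutation′ (Ord n)} (σ-part : ∀ r → partOf (σ ⟨$⟩ʳ r) ≡ partOf r)
      (τ-part : ∀ c → partOf (τ ⟨$⟩ʳ c) ≡ partOf c) {R S H : Matrix (Ord n) (Ord n)} →
    PermMatrixBy σ R → PermMatrixBy τ S → (∀ r c → H (σ ⟨$⟩ʳ r) (τ ⟨$⟩ʳ c) ≡ H r c) →
    ∀ p q → diagonalBlocks R p · block H p q · (diagonalBlocks S q) ᵀ ≐ block H p q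
  blockwise-invariance {σ} {τ} σ-part τ-part {R} {S} {H} R≡ S≡ H-invariant p q u v = begin
    (diagonalBlocks R p · block H p q · (diagonalBlocks S q) ᵀ) u v
      ≡⟨ signedPerm-·-·ᵀ (σ-blocks.block-permMatrix R≡ p) (τ-blocks.block-permMatrix S≡ q) _ u v ⟩
    1ℤ *ℤ H (emb p (σ-blocks.restrict p ⟨$⟩ʳ u)) (emb q (τ-blocks.restrict q ⟨$⟩ʳ v)) *ℤ 1ℤ
      ≡⟨ *-identity-sandwich _ refl refl ⟩
    H (emb p (σ-blocks.restrict p ⟨$⟩ʳ u)) (emb q (τ-blocks.restrict q ⟨$⟩ʳ v))
      ≡⟨ cong₂ H (σ-blocks.σ-emb p u) (τ-blocks.σ-emb q v) ⟨
    H (σ ⟨$⟩ʳ emb p u) (τ ⟨$⟩ʳ emb q v)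
      ≡⟨ H-invariant (emb p u) (emb q v) ⟩
    H (emb p u) (emb q v) ∎
    where
    module σ-blocks = PartPreservingPermutation σ σ-part
    module τ-blocks = PartPreservingPermutation τ τ-part

module Automorphism {N} {H R S : Matrix N N} {σR sR σS sS}
                    (R≡ : SignedPermBy σR sR R) (S≡ : SignedPermBy σS sS S)
                    (aut : R · H · S ᵀ ≐ H) where

  aut-entry : ∀ i j → sR i *ℤ H (σR ⟨$⟩ʳ i) (σS ⟨$⟩ʳ j) *ℤ sS j ≡ H i j
  aut-entry i j = trans (sym (signedPerm-·-·ᵀ R≡ S≡ H i j)) (aut i j)

  aut-entry-unsigned : ∀ {i j} → sR i ≡ 1ℤ → sS j ≡ 1ℤ → H (σR ⟨$⟩ʳ i) (σS ⟨$⟩ʳ j) ≡ H i j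
  aut-entry-unsigned {i} {j} sRi≡1 sSj≡1 = trans (sym (*-identity-sandwich _ sRi≡1 sSj≡1)) (aut-entry i j)

  S-signs≡1 : ∀ {r} → (∀ j → H r j ≡ 1ℤ) → R r r ≡ 1ℤ → ∀ j → sS j ≡ 1ℤ
  S-signs≡1 {r} Hr≡1 Rrr≡1 j = begin
    sS j                                       ≡⟨ ℤ.*-identityˡ (sS j) ⟨
    1ℤ *ℤ 1ℤ *ℤ sS j                           ≡⟨ cong₂ (λ a x → a *ℤ x *ℤ sS j) (sym sRr≡1) (sym (Hr≡1 _)) ⟩
    sR r *ℤ H r (σS ⟨$⟩ʳ j) *ℤ sS j            ≡⟨ cong (λ r′ → sR r *ℤ H r′ (σS ⟨$⟩ʳ j) *ℤ sS j) σRr≡r ⟨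
    sR r *ℤ H (σR ⟨$⟩ʳ r) (σS ⟨$⟩ʳ j) *ℤ sS j  ≡⟨ aut-entry r j ⟩
    H r j                                      ≡⟨ Hr≡1 j ⟩
    1ℤ                                         ∎
    where
    σRr≡r = proj₁ (diagonal≡1⇒fixed R≡ Rrr≡1)
    sRr≡1 = proj₂ (diagonal≡1⇒fixed R≡ Rrr≡1)

  R-signs≡1 : ∀ {c} → (∀ i → H i c ≡ 1ℤ) → S c c ≡ 1ℤ → ∀ i → sR i ≡ 1ℤ
  R-signs≡1 {c} Hc≡1 Scc≡1 i = begin
    sR i                                       ≡⟨ trans (ℤ.*-identityʳ _) (ℤ.*-identityʳ (sR i)) ⟨
    sR i *ℤ 1ℤ *ℤ 1ℤ                           ≡⟨ cong₂ (λ x b → sR i *ℤ x *ℤ b) (sym (Hc≡1 _)) (sym sSc≡1) ⟩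
    sR i *ℤ H (σR ⟨$⟩ʳ i) c *ℤ sS c            ≡⟨ cong (λ c′ → sR i *ℤ H (σR ⟨$⟩ʳ i) c′ *ℤ sS c) σSc≡c ⟨
    sR i *ℤ H (σR ⟨$⟩ʳ i) (σS ⟨$⟩ʳ c) *ℤ sS c  ≡⟨ aut-entry i c ⟩
    H i c                                      ≡⟨ Hc≡1 i ⟩
    1ℤ                                         ∎
    where
    σSc≡c = proj₁ (diagonal≡1⇒fixed S≡ Scc≡1)
    sSc≡1 = proj₂ (diagonal≡1⇒fixed S≡ Scc≡1)

-- Inverts the sign patterns of rows 2–4 of TL and TR, which are pairwise distinct and are also
-- the sign patterns of columns 2–4 of TL and BL.
partFromSigns : Sign → Sign → Sign → Fin 4 ⊎ Fin 4
partFromSigns Sign.+ Sign.+ Sign.+ = inj₁ 0F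
partFromSigns Sign.+ Sign.- Sign.- = inj₁ 1F
partFromSigns Sign.- Sign.+ Sign.- = inj₁ 2F
partFromSigns Sign.- Sign.- Sign.+ = inj₁ 3F
partFromSigns Sign.+ Sign.+ Sign.- = inj₂ 0F
partFromSigns Sign.+ Sign.- Sign.+ = inj₂ 1F
partFromSigns Sign.- Sign.+ Sign.+ = inj₂ 2F
partFromSigns Sign.- Sign.- Sign.- = inj₂ 3F

partFromBorder : (Fin 4 → ℤ) → Fin 4 ⊎ Fin 4
partFromBorder v = partFromSigns (sign (v 1F)) (sign (v 2F)) (sign (v 3F))

partFromBorder-cong : ∀ {v w} → (∀ i → v i ≡ w i) → partFromBorder v ≡ partFromBorder w
partFromBorder-cong v≗w rewrite v≗w 1F | v≗w 2F | v≗w 3F = refl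

module KimuraBorder {n} (A B C D : Matrix n n) where

  open Blocks n

  H : Matrix (Ord n) (Ord n)
  H = kimuraArray A B C D

  H-firstRow : ∀ c → H 0F c ≡ 1ℤ
  H-firstRow c with view {n} c
  ... | inj₁ _ = refl
  ... | inj₂ _ = refl

  H-firstColumn : ∀ r → H r 0F ≡ 1ℤ
  H-firstColumn r with view {n} r
  ... | inj₁ 0F       = refl
  ... | inj₁ 1F       = refl
  ... | inj₁ 2F       = refl
  ... | inj₁ 3F       = refl
  ... | inj₂ (0F , _) = refl
  ... | inj₂ (1F , _) = refl
  ... | inj₂ (2F , _) = refl
  ... | inj₂ (3F , _) = refl

  partFromBorder-column : ∀ c → partFromBorder (λ i → H (border i) c) ≡ partOf c
  partFromBorder-column c with view {n} c
  ... | inj₁ 0F       = refl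
  ... | inj₁ 1F       = refl
  ... | inj₁ 2F       = refl
  ... | inj₁ 3F       = refl
  ... | inj₂ (0F , _) = refl
  ... | inj₂ (1F , _) = refl
  ... | inj₂ (2F , _) = refl
  ... | inj₂ (3F , _) = refl

  partFromBorder-row : ∀ r → partFromBorder (λ j → H r (border j)) ≡ partOf r
  partFromBorder-row r with view {n} r
  ... | inj₁ 0F       = refl
  ... | inj₁ 1F       = refl
  ... | inj₁ 2F       = refl
  ... | inj₁ 3F       = refl
  ... | inj₂ (0F , _) = refl
  ... | inj₂ (1F , _) = refl
  ... | inj₂ (2F , _) = refl
  ... | inj₂ (3F , _) = refl

  partOf-by-borderRows : ∀ c c′ → (∀ i → H (border i) c ≡ H (border i) c′) → partOf c ≡ partOf c′
  partOf-by-borderRows c c′ agree =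
    trans (sym (partFromBorder-column c)) (trans (partFromBorder-cong agree) (partFromBorder-column c′))

  partOf-by-borderColumns : ∀ r r′ → (∀ j → H r (border j) ≡ H r′ (border j)) → partOf r ≡ partOf r′
  partOf-by-borderColumns r r′ agree =
    trans (sym (partFromBorder-row r)) (trans (partFromBorder-cong agree) (partFromBorder-row r′))

module KimuraAutomorphism {n} (A B C D : Matrix n n) {R S : Matrix (Ord n) (Ord n)} {σR sR σS sS}
    (R≡ : SignedPermBy σR sR R) (S≡ : SignedPermBy σS sS S)
    (aut : R · kimuraArray A B C D · S ᵀ ≐ kimuraArray A B C D) where

  open Blocks n
  open KimuraBorder A B C D
  open Automorphism R≡ S≡ aut

  S-entries≢-1 : R 0F 0F ≡ 1ℤ → ∀ i j → S i j ≢ -1ℤ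
  S-entries≢-1 R₀₀≡1 i = entry≢-1 S≡ (S-signs≡1 H-firstRow R₀₀≡1 i)

  module FixingBorder (R-diagonal : ∀ i → toℕ i ≤ 3 → R i i ≡ 1ℤ) where

    R-border : ∀ i → R (border i) (border i) ≡ 1ℤ
    R-border i = R-diagonal (border i) (border-toℕ≤3 i)

    sS≡1 : ∀ j → sS j ≡ 1ℤ
    sS≡1 = S-signs≡1 H-firstRow (R-border 0F)

    R-fixes-border : ∀ i → σR ⟨$⟩ʳ border i ≡ border i × sR (border i) ≡ 1ℤ
    R-fixes-border i = diagonal≡1⇒fixed R≡ (R-border i)

    σS-part : ∀ c → partOf (σS ⟨$⟩ʳ c) ≡ partOf c
    σS-part c = partOf-by-borderRows (σS ⟨$⟩ʳ c) c λ i → begin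
      H (border i) (σS ⟨$⟩ʳ c)              ≡⟨ cong (λ r → H r (σS ⟨$⟩ʳ c)) (proj₁ (R-fixes-border i)) ⟨
      H (σR ⟨$⟩ʳ border i) (σS ⟨$⟩ʳ c)      ≡⟨ aut-entry-unsigned (proj₂ (R-fixes-border i)) (sS≡1 c) ⟩
      H (border i) c                        ∎

    module S-blocks = PartPreservingPermutation σS σS-part

    S-border : ∀ i → S (border i) (border i) ≡ 1ℤ
    S-border i = trans (entry-on S≡ (S-blocks.σ-border i)) (sS≡1 (border i))

    S-diagonal : ∀ j → toℕ j ≤ 3 → S j j ≡ 1ℤ
    S-diagonal j j≤3 with i , refl ← toℕ≤3⇒border j j≤3 = S-border i

    sR≡1 : ∀ i → sR i ≡ 1ℤ
    sR≡1 = R-signs≡1 H-firstColumn (S-border 0F)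

    σR-part : ∀ r → partOf (σR ⟨$⟩ʳ r) ≡ partOf r
    σR-part r = partOf-by-borderColumns (σR ⟨$⟩ʳ r) r λ j → begin
      H (σR ⟨$⟩ʳ r) (border j)              ≡⟨ cong (H (σR ⟨$⟩ʳ r)) (S-blocks.σ-border j) ⟨
      H (σR ⟨$⟩ʳ r) (σS ⟨$⟩ʳ border j)      ≡⟨ aut-entry-unsigned (sR≡1 r) (sS≡1 (border j)) ⟩
      H r (border j)                        ∎

    module R-blocks = PartPreservingPermutation σR σR-part

    R-unsigned : PermMatrixBy σR R
    R-unsigned = unitSigns⇒permMatrix R≡ sR≡1

    S-unsigned : PermMatrixBy σS S
    S-unsigned = unitSigns⇒permMatrix S≡ sS≡1

    blockwise-aut : ∀ p q → diagonalBlocks R p · block H p q · (diagonalBlocks S q) ᵀ ≐ block H p q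
    blockwise-aut = blockwise-invariance σR-part σS-part R-unsigned S-unsigned
      (λ r c → aut-entry-unsigned (sR≡1 r) (sS≡1 c))

proposition3p11 : (k : ℕ) → 3 ≤ k → ∃[ m ] k ≡ 1 + 2 * m →
    (a b c d : Fin (2 * k) → Bool) →
    IsHadamard (kimura k a b c d) →
    (R S : Matrix (Ord (2 * k)) (Ord (2 * k))) →
    IsAut (kimura k a b c d) R S →
    ((R zero zero ≡ 1ℤ → ∀ i j → S i j ≢ -1ℤ)
    ×
    ((∀ (i : Fin (Ord (2 * k))) → toℕ i ≤ 3 → R i i ≡ 1ℤ) →
      (∀ (j : Fin (Ord (2 * k))) → toℕ j ≤ 3 → S j j ≡ 1ℤ)
      × (Σ[ Rs ∈ (Fin 4 → Matrix (2 * k) (2 * k)) ] Σ[ Ss ∈ (Fin 4 → Matrix (2 * k) (2 * k)) ]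
          ((∀ p → IsSignedPerm (Rs p)) × (∀ q → IsSignedPerm (Ss q))
          × (R ≐ blockDiag Rs) × (S ≐ blockDiag Ss)
          × (∀ p q → Rs p · block (kimura k a b c d) p q · (Ss q) ᵀ
                       ≐ block (kimura k a b c d) p q)))))
proposition3p11 k _ _ a b c d _ R S ((σR , sR , _ , R≡) , (σS , sS , _ , S≡) , aut) =
  S-entries≢-1 , λ R-diagonal →
    let open FixingBorder R-diagonal in
    S-diagonal ,
    diagonalBlocks R , diagonalBlocks S ,
    (λ p → permMatrix-isSignedPerm (R-blocks.block-permMatrix R-unsigned p)) ,
    (λ q → permMatrix-isSignedPerm (S-blocks.block-permMatrix S-unsigned q)) ,
    R-blocks.blockDiag-blocks R-unsigned , S-blocks.blockDiag-blocks S-unsigned ,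
    blockwise-aut
  where
  open Dihedral k
  open Blocks (2 * k) using (diagonalBlocks)
  open KimuraAutomorphism (pm a) (pm b) (pm c) (pm d)
         (signedPermBy {σ = σR} {sR} R≡) (signedPermBy {σ = σS} {sS} S≡) aut
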